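{- Let $G$ be a graph of order $n$ with vertices $v_1,\dots,v_n$, vertex degrees $d_i=\deg(v_i)$ for $i=1,\dots,n$, and maximum degree $\Delta=\Delta(G)$. Then $$\rho(G)=L_1(G)\ \ge\ \sum_{i=1}^{n}\frac{1}{d_i\,\Delta+1}.$$
   Context: All graphs are finite, simple and undirected. For a vertex $v$, $N[v]$ denotes the closed neighbourhood of $v$. A vertex set $X\subseteq V(G)$ is a $1$-limited packing if $|N[v]\cap X|\le 1$ for every $v\in V(G)$ (equivalently, any two vertices of $X$ are at distance at least $3$); $L_1(G)$ is the maximum size of such a set, and the $2$-packing number is $\rho(G)=L_1(G)$. -}

module Defs where

open import Data.Bool using (Bool; true; false; if_then_else_)
open import Data.Nat using (ℕ; zero; suc; _*_; _⊔_; _≤_; _≤?_)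
open import Data.Fin using (Fin)
open import Data.Fin.Properties using (all?)
open import Data.Fin.Subset using (Subset; ⁅_⁆; _∪_; _∩_; ∣_∣; inside; outside)
open import Data.Vec using (Vec; tabulate; _∷_)
open import Data.List using (List; []; _∷_; map; foldr; allFin; _++_)
open import Data.Integer using (+_)
open import Data.Rational using (ℚ; _/_; 0ℚ) renaming (_+_ to _+ℚ_)
open import Relation.Nullary using (Dec; does)
open import Relation.Binary.PropositionalEquality using (_≡_)

record Graph (n : ℕ) : Set where
  field
    adj    : Fin n → Fin n → Bool
    sym    : ∀ i j → adj i j ≡ adj j i
    irrefl : ∀ i → adj i i ≡ false

open Graph public

module _ {n : ℕ} (G : Graph n) where

  nbhd : Fin n → Subset n
  nbhd v = tabulate (adj G v)

  closedNbhd : Fin n → Subset n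
  closedNbhd v = ⁅ v ⁆ ∪ nbhd v

  deg : Fin n → ℕ
  deg v = ∣ nbhd v ∣

  -- maximum degree Δ(G) (0 for the empty graph on no vertices)
  maxDeg : ℕ
  maxDeg = foldr _⊔_ 0 (map deg (allFin n))

  IsLimitedPacking₁ : Subset n → Set
  IsLimitedPacking₁ X = ∀ v → ∣ closedNbhd v ∩ X ∣ ≤ 1

  isLimitedPacking₁? : (X : Subset n) → Dec (IsLimitedPacking₁ X)
  isLimitedPacking₁? X = all? (λ v → ∣ closedNbhd v ∩ X ∣ ≤? 1)

allSubsets : (n : ℕ) → List (Subset n)
allSubsets zero = Data.Vec.[] ∷ []
allSubsets (suc n) = map (inside ∷_) (allSubsets n) ++ map (outside ∷_) (allSubsets n)

L₁ : {n : ℕ} → Graph n → ℕ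
L₁ {n} G = foldr _⊔_ 0
  (map (λ X → if does (isLimitedPacking₁? G X) then ∣ X ∣ else 0) (allSubsets n))

ρ : {n : ℕ} → Graph n → ℕ
ρ = L₁

bound : {n : ℕ} → Graph n → ℚ
bound {n} G = foldr _+ℚ_ 0ℚ
  (map (λ i → (+ 1) / suc (deg G i * maxDeg G)) (allFin n))

ℕtoℚ : ℕ → ℚ
ℕtoℚ k = + k / 1

-- Greedy argument: among the remaining vertices S pick v minimising d_v Δ, put it
-- into the packing and delete from S every vertex at distance at most 2 from v.
-- There are at most 1 + d_v Δ of those, each of weight 1/(d_u Δ + 1) ≤ 1/(d_v Δ + 1),
-- so every step removes weight at most 1 from S while adding one vertex to the
-- packing, and the chosen vertices are pairwise at distance at least 3.
module Submission where

open import Defs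
open import Data.Nat using (ℕ)
open import Data.Rational using (_≤_)

open import Data.Bool using (true; if_then_else_)
open import Data.Empty using (⊥; ⊥-elim)
open import Data.Fin using (Fin; zero; suc; _≟_)
open import Data.Fin.Subset
  using (Subset; inside; outside; _∈_; _∉_; _⊆_; _⊂_; _∪_; _∩_; _─_; _-_; ⁅_⁆; ∣_∣; ⊤; Nonempty; Empty)
  renaming (⊥ to ∅)
open import Data.Fin.Subset.Properties
  using ( _∈?_; nonempty?; Empty-unique; ∣⊥∣≡0; x∈⁅x⁆; x∈⁅y⁆⇒x≡y; x≢y⇒x∉⁅y⁆; ∣⁅x⁆∣≡1
        ; p⊆q⇒∣p∣≤∣q∣; p⊂q⇒∣p∣<∣q∣; x∈p∪q⁻; x∈p∪q⁺; q⊆p∪q; x∈p∩q⁺; x∈p∩q⁻; ∣p∩q∣≤∣q∣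
        ; x∈p∧x∉q⇒x∈p─q; p─q⊆p; p∩q≢∅⇒p─q⊂p; x∈p⇒∣p-x∣<∣p∣ )
open import Data.Fin.Subset.Induction using (Acc; acc; ⊂-wellFounded)
open import Data.Integer as ℤ using (+_)
import Data.Integer.Properties as ℤ
open import Data.Integer.Tactic.RingSolver using (solve-∀)
open import Data.List using (_∷_; foldr; map; filter; allFin; tabulate)
open import Data.List.Extrema.Nat using (argmin; argmin-sel; f[argmin]≤f[xs])
open import Data.List.Membership.Propositional using () renaming (_∈_ to _∈ˡ_)
open import Data.List.Membership.Propositional.Properties
  using (∈-allFin; ∈-filter⁺; ∈-filter⁻; ∈-map⁺; ∈-++⁺ˡ; ∈-++⁺ʳ)
open import Data.List.Properties using (map-tabulate)
import Data.List.Relation.Unary.All as All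
import Data.List.Relation.Unary.Any as Any
open import Data.Nat as ℕ using (zero; suc; z≤n; s≤s)
open import Data.Nat.Properties as ℕ using (≤-trans; +-suc; +-monoʳ-≤; +-mono-≤)
open import Data.Product using (∃-syntax; _×_; _,_; proj₁; proj₂)
open import Data.Rational as ℚ using (ℚ; _/_; 0ℚ; _+_; fromℚᵘ)
import Data.Rational.Properties as ℚ
open import Data.Rational.Unnormalised as ℚᵘ using (mkℚᵘ; *≡*; *≤*)
import Data.Rational.Unnormalised.Properties as ℚᵘ
open import Data.Sum as Sum using (_⊎_; inj₁; inj₂; [_,_]′)
open import Data.Vec as Vec using (_∷_; here; there)
import Data.Vec.Properties as Vec
open import Relation.Nullary using (yes; no; does)
open import Relation.Nullary.Decidable as Dec using (dec-true)
open import Relation.Binary.PropositionalEquality as ≡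
  using (_≡_; refl; trans; cong; subst; subst₂)

private variable n m : ℕ

fromℚᵘ-mono-≤ : ∀ {p q} → p ℚᵘ.≤ q → fromℚᵘ p ≤ fromℚᵘ q
fromℚᵘ-mono-≤ {p} {q} p≤q = ℚ.toℚᵘ-cancel-≤
  (ℚᵘ.≤-respʳ-≃ (ℚᵘ.≃-sym (ℚ.toℚᵘ-fromℚᵘ q)) (ℚᵘ.≤-respˡ-≃ (ℚᵘ.≃-sym (ℚ.toℚᵘ-fromℚᵘ p)) p≤q))

fromℚᵘ-homo-+ : ∀ p q → fromℚᵘ (p ℚᵘ.+ q) ≡ fromℚᵘ p + fromℚᵘ q
fromℚᵘ-homo-+ p q = ℚ.toℚᵘ-injective (ℚᵘ.≃-trans (ℚ.toℚᵘ-fromℚᵘ (p ℚᵘ.+ q)) (ℚᵘ.≃-sym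
  (ℚᵘ.≃-trans (ℚ.toℚᵘ-homo-+ (fromℚᵘ p) (fromℚᵘ q)) (ℚᵘ.+-cong (ℚ.toℚᵘ-fromℚᵘ p) (ℚ.toℚᵘ-fromℚᵘ q)))))

/suc-+-1 : ∀ k m → + k / suc m + + 1 / suc m ≡ + suc k / suc m
/suc-+-1 k m = trans (≡.sym (fromℚᵘ-homo-+ (mkℚᵘ (+ k) m) (mkℚᵘ (+ 1) m)))
  (ℚ.fromℚᵘ-cong {mkℚᵘ (+ k) m ℚᵘ.+ mkℚᵘ (+ 1) m} {mkℚᵘ (+ suc k) m} (*≡* cross))
  where
  d = + suc m
  cross : (+ k ℤ.* d ℤ.+ + 1 ℤ.* d) ℤ.* d ≡ + suc k ℤ.* (d ℤ.* d)
  cross = trans (ring (+ k) d) (cong (ℤ._* (d ℤ.* d)) (≡.sym (ℤ.pos-+ 1 k)))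
    where
    ring : ∀ x d → (x ℤ.* d ℤ.+ + 1 ℤ.* d) ℤ.* d ≡ (+ 1 ℤ.+ x) ℤ.* (d ℤ.* d)
    ring = solve-∀

/suc-monoˡ-≤ : ∀ {k l} m → k ℕ.≤ l → + k / suc m ≤ + l / suc m
/suc-monoˡ-≤ {k} {l} m k≤l =
  fromℚᵘ-mono-≤ {mkℚᵘ (+ k) m} {mkℚᵘ (+ l) m} (*≤* (ℤ.*-monoʳ-≤-nonNeg (+ suc m) (ℤ.+≤+ k≤l)))

1/suc-antimono-≤ : ∀ {m m'} → m ℕ.≤ m' → + 1 / suc m' ≤ + 1 / suc m
1/suc-antimono-≤ {m} {m'} m≤m' = fromℚᵘ-mono-≤ {mkℚᵘ (+ 1) m'} {mkℚᵘ (+ 1) m}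
  (*≤* (subst₂ ℤ._≤_ (≡.sym (ℤ.*-identityˡ _)) (≡.sym (ℤ.*-identityˡ _)) (ℤ.+≤+ (s≤s m≤m'))))

/suc≤1 : ∀ {k m} → k ℕ.≤ suc m → + k / suc m ≤ ℕtoℚ 1
/suc≤1 {k} {m} k≤1+m = fromℚᵘ-mono-≤ {mkℚᵘ (+ k) m} {mkℚᵘ (+ 1) 0}
  (*≤* (subst₂ ℤ._≤_ (≡.sym (ℤ.*-identityʳ _)) (≡.sym (ℤ.*-identityˡ _)) (ℤ.+≤+ k≤1+m)))

ℕtoℚ-mono-≤ : ∀ {k l} → k ℕ.≤ l → ℕtoℚ k ≤ ℕtoℚ l
ℕtoℚ-mono-≤ = /suc-monoˡ-≤ 0

ℕtoℚ-suc : ∀ k → ℕtoℚ k + ℕtoℚ 1 ≡ ℕtoℚ (suc k)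
ℕtoℚ-suc k = /suc-+-1 k 0

∣p∪q∣≤∣p∣+∣q∣ : ∀ (p q : Subset n) → ∣ p ∪ q ∣ ℕ.≤ ∣ p ∣ ℕ.+ ∣ q ∣
∣p∪q∣≤∣p∣+∣q∣ Vec.[] Vec.[] = z≤n
∣p∪q∣≤∣p∣+∣q∣ (inside ∷ p) (inside ∷ q) = s≤s (≤-trans (∣p∪q∣≤∣p∣+∣q∣ p q) (+-monoʳ-≤ ∣ p ∣ (ℕ.n≤1+n ∣ q ∣)))
∣p∪q∣≤∣p∣+∣q∣ (inside ∷ p) (outside ∷ q) = s≤s (∣p∪q∣≤∣p∣+∣q∣ p q)
∣p∪q∣≤∣p∣+∣q∣ (outside ∷ p) (inside ∷ q) = subst (ℕ._≤_ _) (≡.sym (+-suc ∣ p ∣ ∣ q ∣)) (s≤s (∣p∪q∣≤∣p∣+∣q∣ p q))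
∣p∪q∣≤∣p∣+∣q∣ (outside ∷ p) (outside ∷ q) = ∣p∪q∣≤∣p∣+∣q∣ p q

x∈p─q⇒x∉q : ∀ {x : Fin n} (p q : Subset n) → x ∈ p ─ q → x ∉ q
x∈p─q⇒x∉q (_ ∷ p) (_ ∷ q) (there x∈p─q) (there x∈q) = x∈p─q⇒x∉q p q x∈p─q x∈q

x∈⁅y⁆∪p⁻ : ∀ {x : Fin n} y p → x ∈ ⁅ y ⁆ ∪ p → x ≡ y ⊎ x ∈ p
x∈⁅y⁆∪p⁻ y p x∈ = Sum.map₁ (x∈⁅y⁆⇒x≡y y) (x∈p∪q⁻ ⁅ y ⁆ p x∈)

unique⇒∣p∣≤1 : (p : Subset n) → (∀ {x y} → x ∈ p → y ∈ p → x ≡ y) → ∣ p ∣ ℕ.≤ 1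
unique⇒∣p∣≤1 {n} p unique with nonempty? p
... | no  empty = subst (ℕ._≤ 1) (≡.sym (trans (cong ∣_∣ (Empty-unique empty)) (∣⊥∣≡0 n))) z≤n
... | yes (x , x∈p) = subst (∣ p ∣ ℕ.≤_) (∣⁅x⁆∣≡1 x)
  (p⊆q⇒∣p∣≤∣q∣ λ y∈p → subst (_∈ ⁅ x ⁆) (unique x∈p y∈p) (x∈⁅x⁆ x))

∃-argmin : (f : Fin n → ℕ) {p : Subset n} → Nonempty p →
           ∃[ v ] v ∈ p × (∀ {u} → u ∈ p → f v ℕ.≤ f u)
∃-argmin {n} f {p} (x , x∈p) = v , v∈p , v-min
  where
  candidates = filter (_∈? p) (allFin n)
  v = argmin f x candidates
  v∈p : v ∈ p
  v∈p with argmin-sel f x candidates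
  ... | inj₁ v≡x = subst (_∈ p) (≡.sym v≡x) x∈p
  ... | inj₂ v∈candidates = proj₂ (∈-filter⁻ (_∈? p) {xs = allFin n} v∈candidates)
  v-min : ∀ {u} → u ∈ p → f v ℕ.≤ f u
  v-min u∈p = All.lookup (f[argmin]≤f[xs] x candidates) (∈-filter⁺ (_∈? p) (∈-allFin _) u∈p)

⋃[_]_ : Subset n → (Fin n → Subset m) → Subset m
⋃[ Vec.[] ] B = ∅
⋃[ inside ∷ p ] B = B zero ∪ ⋃[ p ] (λ i → B (suc i))
⋃[ outside ∷ p ] B = ⋃[ p ] (λ i → B (suc i))

x∈⋃⁺ : ∀ {p : Subset n} {B : Fin n → Subset m} {i x} → i ∈ p → x ∈ B i → x ∈ ⋃[ p ] B
x∈⋃⁺ {p = inside ∷ p} here x∈B = x∈p∪q⁺ (inj₁ x∈B)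
x∈⋃⁺ {p = inside ∷ p} {B} (there i∈p) x∈B = x∈p∪q⁺ (inj₂ (x∈⋃⁺ {p = p} i∈p x∈B))
x∈⋃⁺ {p = outside ∷ p} (there i∈p) x∈B = x∈⋃⁺ {p = p} i∈p x∈B

∣⋃∣≤∣p∣*c : ∀ (p : Subset n) {B : Fin n → Subset m} {c} → (∀ {i} → i ∈ p → ∣ B i ∣ ℕ.≤ c) →
            ∣ ⋃[ p ] B ∣ ℕ.≤ ∣ p ∣ ℕ.* c
∣⋃∣≤∣p∣*c {m = m} Vec.[] _ = subst (ℕ._≤ 0) (≡.sym (∣⊥∣≡0 m)) z≤n
∣⋃∣≤∣p∣*c (inside ∷ p) {B} small = ≤-trans (∣p∪q∣≤∣p∣+∣q∣ (B zero) _)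
  (+-mono-≤ (small here) (∣⋃∣≤∣p∣*c p (λ i∈p → small (there i∈p))))
∣⋃∣≤∣p∣*c (outside ∷ p) small = ∣⋃∣≤∣p∣*c p (λ i∈p → small (there i∈p))

weight : (Fin n → ℚ) → Subset n → ℚ
weight w Vec.[] = 0ℚ
weight w (inside ∷ p) = w zero + weight (λ i → w (suc i)) p
weight w (outside ∷ p) = weight (λ i → w (suc i)) p

weight-∅ : ∀ (w : Fin n → ℚ) → weight w ∅ ≡ 0ℚ
weight-∅ {zero} w = refl
weight-∅ {suc n} w = weight-∅ (λ i → w (suc i))

weight-Empty : ∀ (w : Fin n → ℚ) {p} → Empty p → weight w p ≡ 0ℚ
weight-Empty w p-empty = trans (cong (weight w) (Empty-unique p-empty)) (weight-∅ w)

foldr-tabulate≡weight-⊤ : ∀ (w : Fin n → ℚ) → foldr _+_ 0ℚ (tabulate w) ≡ weight w ⊤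
foldr-tabulate≡weight-⊤ {zero} w = refl
foldr-tabulate≡weight-⊤ {suc n} w = cong (λ r → w zero + r) (foldr-tabulate≡weight-⊤ (λ i → w (suc i)))

weight-∩-─ : ∀ (w : Fin n → ℚ) p q → weight w p ≡ weight w (p ∩ q) + weight w (p ─ q)
weight-∩-─ w Vec.[] Vec.[] = ≡.sym (ℚ.+-identityˡ 0ℚ)
weight-∩-─ w (inside ∷ p) (inside ∷ q) =
  trans (cong (λ r → w zero + r) (weight-∩-─ _ p q)) (≡.sym (ℚ.+-assoc (w zero) _ _))
weight-∩-─ w (inside ∷ p) (outside ∷ q) = begin
  w zero + weight w′ p                   ≡⟨ cong (λ r → w zero + r) (weight-∩-─ w′ p q) ⟩
  w zero + (weight w′ (p ∩ q) + rest)     ≡⟨ ≡.sym (ℚ.+-assoc (w zero) _ rest) ⟩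
  (w zero + weight w′ (p ∩ q)) + rest     ≡⟨ cong (_+ rest) (ℚ.+-comm (w zero) _) ⟩
  (weight w′ (p ∩ q) + w zero) + rest     ≡⟨ ℚ.+-assoc (weight w′ (p ∩ q)) (w zero) rest ⟩
  weight w′ (p ∩ q) + (w zero + rest)     ∎
  where
  open ≡.≡-Reasoning
  w′ = λ i → w (suc i)
  rest = weight w′ (p ─ q)
weight-∩-─ w (outside ∷ p) (inside ∷ q) = weight-∩-─ _ p q
weight-∩-─ w (outside ∷ p) (outside ∷ q) = weight-∩-─ _ p q

weight≤∣p∣/suc : ∀ (w : Fin n → ℚ) m p → (∀ {x} → x ∈ p → w x ≤ + 1 / suc m) →
                 weight w p ≤ + ∣ p ∣ / suc m
weight≤∣p∣/suc w m Vec.[] _ = ℚ.≤-reflexive (≡.sym (ℚ.0/n≡0 (suc m)))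
weight≤∣p∣/suc w m (inside ∷ p) small = begin
  w zero + weight _ p                     ≤⟨ ℚ.+-mono-≤ (small here) (weight≤∣p∣/suc _ m p (λ x∈p → small (there x∈p))) ⟩
  + 1 / suc m + + ∣ p ∣ / suc m           ≡⟨ ℚ.+-comm (+ 1 / suc m) _ ⟩
  + ∣ p ∣ / suc m + + 1 / suc m           ≡⟨ /suc-+-1 ∣ p ∣ m ⟩
  + suc ∣ p ∣ / suc m                     ∎
  where open ℚ.≤-Reasoning
weight≤∣p∣/suc w m (outside ∷ p) small = weight≤∣p∣/suc _ m p (λ x∈p → small (there x∈p))

≤-foldr-⊔ : ∀ {A : Set} (g : A → ℕ) {x} xs → x ∈ˡ xs → g x ℕ.≤ foldr ℕ._⊔_ 0 (map g xs)
≤-foldr-⊔ g (y ∷ xs) (Any.here refl) = ℕ.m≤m⊔n (g y) _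
≤-foldr-⊔ g (y ∷ xs) (Any.there x∈xs) = ≤-trans (≤-foldr-⊔ g xs x∈xs) (ℕ.m≤n⊔m (g y) _)

∈-allSubsets : ∀ (p : Subset n) → p ∈ˡ allSubsets n
∈-allSubsets Vec.[] = Any.here refl
∈-allSubsets (inside ∷ p) = ∈-++⁺ˡ (∈-map⁺ (inside ∷_) (∈-allSubsets p))
∈-allSubsets {suc n} (outside ∷ p) = ∈-++⁺ʳ (map (inside ∷_) (allSubsets n)) (∈-map⁺ (outside ∷_) (∈-allSubsets p))

module _ {n : ℕ} (G : Graph n) where

  deg≤maxDeg : ∀ v → deg G v ℕ.≤ maxDeg G
  deg≤maxDeg v = ≤-foldr-⊔ (deg G) (allFin n) (∈-allFin v)

  nbhd-sym : ∀ {x v} → x ∈ nbhd G v → v ∈ nbhd G x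
  nbhd-sym {x} {v} x∈N = Vec.lookup⇒[]= v (nbhd G x) (begin
    Vec.lookup (nbhd G x) v   ≡⟨ Vec.lookup∘tabulate (adj G x) v ⟩
    adj G x v                 ≡⟨ Graph.sym G x v ⟩
    adj G v x                 ≡⟨ Vec.lookup∘tabulate (adj G v) x ⟨
    Vec.lookup (nbhd G v) x   ≡⟨ Vec.[]=⇒lookup x∈N ⟩
    true                      ∎)
    where open ≡.≡-Reasoning

  ∈-closedNbhd-self : ∀ v → v ∈ closedNbhd G v
  ∈-closedNbhd-self v = x∈p∪q⁺ (inj₁ (x∈⁅x⁆ v))

  ∣closedNbhd∣≤1+deg : ∀ v → ∣ closedNbhd G v ∣ ℕ.≤ suc (deg G v)
  ∣closedNbhd∣≤1+deg v = ≤-trans (∣p∪q∣≤∣p∣+∣q∣ ⁅ v ⁆ (nbhd G v)) (ℕ.≤-reflexive (cong (ℕ._+ deg G v) (∣⁅x⁆∣≡1 v)))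

  -- The vertices at distance at most 2 from v; removing v from each N[a]
  -- is what makes the union bound give 1 + deg v · Δ.
  closedNbhd₂ : Fin n → Subset n
  closedNbhd₂ v = ⁅ v ⁆ ∪ ⋃[ nbhd G v ] (λ a → closedNbhd G a - v)

  ∈-closedNbhd₂-self : ∀ v → v ∈ closedNbhd₂ v
  ∈-closedNbhd₂-self v = x∈p∪q⁺ (inj₁ (x∈⁅x⁆ v))

  ∈-closedNbhd₂ : ∀ {a v y} → v ∈ closedNbhd G a → y ∈ closedNbhd G a → y ∈ closedNbhd₂ v
  ∈-closedNbhd₂ {a} {v} {y} v∈N[a] y∈N[a] with y ≟ v
  ... | yes refl = ∈-closedNbhd₂-self y
  ... | no y≢v with neighbour
    where
    neighbour : ∃[ b ] b ∈ nbhd G v × y ∈ closedNbhd G b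
    neighbour with x∈⁅y⁆∪p⁻ a (nbhd G a) v∈N[a] | x∈⁅y⁆∪p⁻ a (nbhd G a) y∈N[a]
    ... | inj₁ refl | inj₁ refl = ⊥-elim (y≢v refl)
    ... | inj₁ refl | inj₂ y∈N[v] = y , y∈N[v] , ∈-closedNbhd-self y
    ... | inj₂ v∈N[a] | _ = a , nbhd-sym v∈N[a] , y∈N[a]
  ... | b , b∈N[v] , y∈N[b] =
    x∈p∪q⁺ (inj₂ (x∈⋃⁺ {p = nbhd G v} b∈N[v] (x∈p∧x∉q⇒x∈p─q y∈N[b] (x≢y⇒x∉⁅y⁆ y≢v))))

  ∣closedNbhd₂∣≤1+deg*Δ : ∀ v → ∣ closedNbhd₂ v ∣ ℕ.≤ suc (deg G v ℕ.* maxDeg G)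
  ∣closedNbhd₂∣≤1+deg*Δ v = ≤-trans (∣p∪q∣≤∣p∣+∣q∣ ⁅ v ⁆ _)
    (+-mono-≤ (ℕ.≤-reflexive (∣⁅x⁆∣≡1 v)) (∣⋃∣≤∣p∣*c (nbhd G v) ∣N[a]-v∣≤Δ))
    where
    ∣N[a]-v∣≤Δ : ∀ {a} → a ∈ nbhd G v → ∣ closedNbhd G a - v ∣ ℕ.≤ maxDeg G
    ∣N[a]-v∣≤Δ {a} a∈N[v] = ℕ.≤-pred (≤-trans (x∈p⇒∣p-x∣<∣p∣ (q⊆p∪q ⁅ a ⁆ (nbhd G a) (nbhd-sym a∈N[v])))
      (≤-trans (∣closedNbhd∣≤1+deg a) (s≤s (deg≤maxDeg a))))

  Scattered : Subset n → Set
  Scattered X = ∀ {a x y} → x ∈ X → y ∈ X → x ∈ closedNbhd G a → y ∈ closedNbhd G a → x ≡ y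

  scattered⇒packing : ∀ {X} → Scattered X → IsLimitedPacking₁ G X
  scattered⇒packing {X} X-scattered a = unique⇒∣p∣≤1 (closedNbhd G a ∩ X) λ x∈ y∈ →
    let x∈N[a] , x∈X = x∈p∩q⁻ (closedNbhd G a) X x∈
        y∈N[a] , y∈X = x∈p∩q⁻ (closedNbhd G a) X y∈
    in X-scattered x∈X y∈X x∈N[a] y∈N[a]

  packing≤L₁ : ∀ {X} → IsLimitedPacking₁ G X → ∣ X ∣ ℕ.≤ L₁ G
  packing≤L₁ {X} X-packing = ≤-trans (ℕ.≤-reflexive (≡.sym score-X)) (≤-foldr-⊔ score (allSubsets n) (∈-allSubsets X))
    where
    score : Subset n → ℕ
    score Y = if does (isLimitedPacking₁? G Y) then ∣ Y ∣ else 0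
    score-X : score X ≡ ∣ X ∣
    score-X = cong (λ b → if b then ∣ X ∣ else 0) (dec-true (isLimitedPacking₁? G X) X-packing)

  degΔ : Fin n → ℕ
  degΔ v = deg G v ℕ.* maxDeg G

  vertexWeight : Fin n → ℚ
  vertexWeight v = + 1 / suc (degΔ v)

  bound≡weight-⊤ : bound G ≡ weight vertexWeight ⊤
  bound≡weight-⊤ = trans (cong (foldr _+_ 0ℚ) (map-tabulate (λ i → i) vertexWeight)) (foldr-tabulate≡weight-⊤ vertexWeight)

  weight-near-minimum≤1 : ∀ {v S} → (∀ {u} → u ∈ S → degΔ v ℕ.≤ degΔ u) →
                          weight vertexWeight (S ∩ closedNbhd₂ v) ≤ ℕtoℚ 1
  weight-near-minimum≤1 {v} {S} v-min = begin
    weight vertexWeight (S ∩ closedNbhd₂ v)    ≤⟨ weight≤∣p∣/suc vertexWeight (degΔ v) _ lighter ⟩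
    + ∣ S ∩ closedNbhd₂ v ∣ / suc (degΔ v)     ≤⟨ /suc≤1 (≤-trans (∣p∩q∣≤∣q∣ S _) (∣closedNbhd₂∣≤1+deg*Δ v)) ⟩
    ℕtoℚ 1                                     ∎
    where
    open ℚ.≤-Reasoning
    lighter : ∀ {u} → u ∈ S ∩ closedNbhd₂ v → vertexWeight u ≤ + 1 / suc (degΔ v)
    lighter u∈ = 1/suc-antimono-≤ (v-min (proj₁ (x∈p∩q⁻ S _ u∈)))

  LargePacking : Subset n → Set
  LargePacking S = ∃[ X ] X ⊆ S × Scattered X × weight vertexWeight S ≤ ℕtoℚ ∣ X ∣

  largePacking-extend : ∀ {v S} → v ∈ S → (∀ {u} → u ∈ S → degΔ v ℕ.≤ degΔ u) →
                        LargePacking (S ─ closedNbhd₂ v) → LargePacking S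
  largePacking-extend {v} {S} v∈S v-min (X , X⊆S─B , X-scattered , weight≤∣X∣) =
    ⁅ v ⁆ ∪ X , v∪X⊆S , v∪X-scattered , weight≤∣v∪X∣
    where
    B = closedNbhd₂ v
    far : ∀ {a y} → y ∈ X → v ∈ closedNbhd G a → y ∈ closedNbhd G a → ⊥
    far y∈X v∈N[a] y∈N[a] = x∈p─q⇒x∉q S B (X⊆S─B y∈X) (∈-closedNbhd₂ v∈N[a] y∈N[a])
    v∪X⊆S : ⁅ v ⁆ ∪ X ⊆ S
    v∪X⊆S x∈ with x∈⁅y⁆∪p⁻ v X x∈
    ... | inj₁ refl = v∈S
    ... | inj₂ x∈X = p─q⊆p S B (X⊆S─B x∈X)
    v∪X-scattered : Scattered (⁅ v ⁆ ∪ X)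
    v∪X-scattered x∈ y∈ x∈N[a] y∈N[a] with x∈⁅y⁆∪p⁻ v X x∈ | x∈⁅y⁆∪p⁻ v X y∈
    ... | inj₁ refl | inj₁ refl = refl
    ... | inj₁ refl | inj₂ y∈X = ⊥-elim (far y∈X x∈N[a] y∈N[a])
    ... | inj₂ x∈X | inj₁ refl = ⊥-elim (far x∈X y∈N[a] x∈N[a])
    ... | inj₂ x∈X | inj₂ y∈X = X-scattered x∈X y∈X x∈N[a] y∈N[a]
    ∣X∣<∣v∪X∣ : suc ∣ X ∣ ℕ.≤ ∣ ⁅ v ⁆ ∪ X ∣
    ∣X∣<∣v∪X∣ = p⊂q⇒∣p∣<∣q∣ (q⊆p∪q ⁅ v ⁆ X , v , x∈p∪q⁺ (inj₁ (x∈⁅x⁆ v)) , λ v∈X →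
      x∈p─q⇒x∉q S B (X⊆S─B v∈X) (∈-closedNbhd₂-self v))
    weight≤∣v∪X∣ : weight vertexWeight S ≤ ℕtoℚ ∣ ⁅ v ⁆ ∪ X ∣
    weight≤∣v∪X∣ = begin
      weight vertexWeight S                                       ≡⟨ weight-∩-─ vertexWeight S B ⟩
      weight vertexWeight (S ∩ B) + weight vertexWeight (S ─ B)   ≤⟨ ℚ.+-mono-≤ (weight-near-minimum≤1 v-min) weight≤∣X∣ ⟩
      ℕtoℚ 1 + ℕtoℚ (∣ X ∣)                                       ≡⟨ ℚ.+-comm (ℕtoℚ 1) (ℕtoℚ ∣ X ∣) ⟩
      ℕtoℚ (∣ X ∣) + ℕtoℚ 1                                       ≡⟨ ℕtoℚ-suc (∣ X ∣) ⟩
      ℕtoℚ (suc ∣ X ∣)                                            ≤⟨ ℕtoℚ-mono-≤ ∣X∣<∣v∪X∣ ⟩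
      ℕtoℚ (∣ ⁅ v ⁆ ∪ X ∣)                                        ∎
      where open ℚ.≤-Reasoning

  largePacking-Empty : ∀ {S} → Empty S → LargePacking S
  largePacking-Empty {S} S-empty = S , (λ x∈S → x∈S) , (λ x∈S → ⊥-elim (S-empty (_ , x∈S))) , (begin
    weight vertexWeight S    ≡⟨ weight-Empty vertexWeight S-empty ⟩
    ℕtoℚ 0                   ≤⟨ ℕtoℚ-mono-≤ {0} {∣ S ∣} z≤n ⟩
    ℕtoℚ (∣ S ∣)             ∎)
    where open ℚ.≤-Reasoning

  largePacking : ∀ S → Acc _⊂_ S → LargePacking S
  largePacking S (acc smaller) = [ extend , largePacking-Empty ]′ (Dec.toSum (nonempty? S))
    where
    extend : Nonempty S → LargePacking S
    extend S-nonempty =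
      let v , v∈S , v-min = ∃-argmin degΔ S-nonempty
          S─B⊂S = p∩q≢∅⇒p─q⊂p S (closedNbhd₂ v) (v , x∈p∩q⁺ (v∈S , ∈-closedNbhd₂-self v))
      in largePacking-extend v∈S v-min (largePacking (S ─ closedNbhd₂ v) (smaller S─B⊂S))

theorem3 : {n : ℕ} (G : Graph n) → bound G ≤ ℕtoℚ (ρ G)
theorem3 G = conclude (largePacking G ⊤ (⊂-wellFounded ⊤))
  where
  open ℚ.≤-Reasoning
  conclude : LargePacking G ⊤ → bound G ≤ ℕtoℚ (ρ G)
  conclude (X , _ , X-scattered , weight≤∣X∣) = begin
    bound G                       ≡⟨ bound≡weight-⊤ G ⟩
    weight (vertexWeight G) ⊤     ≤⟨ weight≤∣X∣ ⟩
    ℕtoℚ (∣ X ∣)                  ≤⟨ ℕtoℚ-mono-≤ (packing≤L₁ G (scattered⇒packing G X-scattered)) ⟩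
    ℕtoℚ (ρ G)                    ∎
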